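{- Let $d>3$ be a prime such that $-1$ is a quadratic nonresidue modulo $d$ and $2$ is a quadratic nonresidue modulo $d$. Then the equation $$d=\left(\frac{k}{2j}\right)^2\frac{m^2-e^2}{em}$$ has no solutions $k,j,m,e\in\mathbb{N}$ with $\gcd(m,e)=1$, $\gcd(k,j)=1$ and $m>e>0$.
   Context: For a prime $p>2$, $x\in\{1,\dots,p-1\}$ is a quadratic residue modulo $p$ if there is $y\in\{1,\dots,p-1\}$ with $y^2\equiv x \pmod p$, and a quadratic nonresidue otherwise; $-1$ is interpreted as the residue class $p-1$. -}

module Defs where

open import Data.Nat using (ℕ; _+_; _*_; _≤_; _<_)
open import Data.Product using (Σ; _×_)
open import Relation.Nullary using (¬_)

-- Since 0 ≤ x < p, the
-- congruence y² ≡ x (mod p) is written as y*y = q*p + x for some q.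
QuadraticResidue : ℕ → ℕ → Set
QuadraticResidue p x = Σ ℕ λ y → (1 ≤ y) × (y < p) × (Σ ℕ λ q → y * y ≡ q * p + x)
  where open import Relation.Binary.PropositionalEquality using (_≡_)

QuadraticNonresidue : ℕ → ℕ → Set
QuadraticNonresidue p x = ¬ QuadraticResidue p x

module Submission where

-- The equation says that d · e m (m² − e²) is a square, i.e. that d is the area of a rational
-- right triangle (a congruent number); the two nonresidue hypotheses say d ≡ 3 (mod 8), and
-- such primes are not congruent.  With m = e + p, an even p is halved, since
-- area e (2h) = 4 · area h e.  For odd p the four factors e, e + p, p, 2e + p of the area are
-- pairwise coprime, d divides one of them and the other three are squares.  With e = a², if d
-- divides e + p = a² + c² or 2e + p = a² + b², then −1 is a square modulo d; if d divides p,
-- then 2e + p = f² gives f² ≡ 2a², so 2 is a square.  If d divides e, then p, e + p, 2e + p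
-- are three squares in arithmetic progression; the primitive Pythagorean triple they determine
-- has generators (s, q) with e = 4 · area s q and s + q < e + p, and Fermat's infinite descent
-- concludes.

open import Defs
open import Data.Nat using (ℕ; _+_; _*_; _∸_; _^_; _<_)
open import Data.Nat.GCD using (gcd)
open import Data.Nat.Primality using (Prime)
open import Relation.Binary.PropositionalEquality using (_≡_; _≢_)

open import Data.Nat.Base using (zero; suc; _≤_; z≤n; s≤s; s≤s⁻¹; NonZero; ≢-nonZero; ≢-nonZero⁻¹; >-nonZero; _%_)
open import Data.Nat.Properties
open import Data.Nat.Divisibility
open import Data.Nat.Coprimality as Coprime using (Coprime; coprime-divisor; coprime-Bézout; gcd≡1⇒coprime)
open import Data.Nat.GCD using (gcd[m,n]∣m; gcd[m,n]∣n; gcd-greatest; c*gcd[m,n]≡gcd[cm,cn]; gcd[m,n]≡0⇒m≡0; gcd-GCD; gcd-identityˡ; module Bézout)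
open import Data.Nat.Primality using (prime⇒irreducible; prime⇒nonZero; euclidsLemma; prime[2])
open import Data.Nat.DivMod using (m%n<n; m%n%n≡m%n; [m+kn]%n≡m%n; %-distribˡ-+; %-distribˡ-*)
open import Data.Nat.Induction using (<-rec)
open import Data.Nat.Tactic.RingSolver using (solve-∀)
open import Data.Product using (∃-syntax; _×_; _,_; _,′_; proj₁; proj₂)
open import Data.Sum using (_⊎_; inj₁; inj₂; [_,_]′)
open import Data.Empty using (⊥-elim)
open import Function using (_∘_; id; case_of_)
open import Relation.Nullary using (¬_; contradiction)
open import Relation.Binary.PropositionalEquality using (refl; sym; trans; cong; cong₂; subst; subst₂; module ≡-Reasoning)

IsSquare : ℕ → Set
IsSquare n = ∃[ r ] n ≡ r * r

square-cancel-≤ : ∀ {x y} → x * x ≤ y * y → x ≤ y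
square-cancel-≤ p = ≮⇒≥ λ y<x → <⇒≱ (*-mono-< y<x y<x) p

square-cancel-< : ∀ {x y} → x * x < y * y → x < y
square-cancel-< p = ≰⇒> λ y≤x → <⇒≱ p (*-mono-≤ y≤x y≤x)

square-injective : ∀ {x y} → x * x ≡ y * y → x ≡ y
square-injective e = ≤-antisym (square-cancel-≤ (≤-reflexive e)) (square-cancel-≤ (≤-reflexive (sym e)))

square≢0 : ∀ {n r} → 0 < n → n ≡ r * r → r ≢ 0
square≢0 0<n n≡rr refl = <⇒≢ 0<n (sym n≡rr)

Even Odd : ℕ → Set
Even n = ∃[ h ] n ≡ 2 * h
Odd  n = ∃[ h ] n ≡ 1 + 2 * h

even-or-odd : ∀ n → Even n ⊎ Odd n
even-or-odd zero = inj₁ (0 , refl)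
even-or-odd (suc n) with even-or-odd n
... | inj₁ (h , n≡2h)   = inj₂ (h , cong suc n≡2h)
... | inj₂ (h , n≡1+2h) = inj₁ (suc h , trans (cong suc n≡1+2h) (lemma h))
  where
  lemma : ∀ h → suc (1 + 2 * h) ≡ 2 * suc h
  lemma = solve-∀

odd-square⇒odd : ∀ {r} → Odd (r * r) → Odd r
odd-square⇒odd {r} (h , rr≡1+2h) with even-or-odd r
... | inj₂ r-odd = r-odd
... | inj₁ (g , refl) = ⊥-elim (even≢odd (2 * g * g) h (trans (sym (even-square g)) rr≡1+2h))
  where
  even-square : ∀ g → (2 * g) * (2 * g) ≡ 2 * (2 * g * g)
  even-square = solve-∀

odd-≤-odd : ∀ {x y} → Odd x → Odd y → x ≤ y → ∃[ g ] y ≡ x + 2 * g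
odd-≤-odd {x} {y} (a , refl) (b , refl) x≤y = b ∸ a , (begin
  1 + 2 * b                 ≡⟨ cong (λ t → 1 + 2 * t) (sym (m+[n∸m]≡n a≤b)) ⟩
  1 + 2 * (a + (b ∸ a))     ≡⟨ lemma a (b ∸ a) ⟩
  1 + 2 * a + 2 * (b ∸ a)   ∎)
  where
  open ≡-Reasoning
  a≤b : a ≤ b
  a≤b = *-cancelˡ-≤ 2 (s≤s⁻¹ x≤y)
  lemma : ∀ a g → 1 + 2 * (a + g) ≡ 1 + 2 * a + 2 * g
  lemma = solve-∀

coprime-∣ˡ : ∀ {a b t} → Coprime a b → t ∣ a → Coprime t b
coprime-∣ˡ c t∣a (u∣t , u∣b) = c (∣-trans u∣t t∣a , u∣b)

coprime-∣ʳ : ∀ {a b t} → Coprime a b → t ∣ b → Coprime a t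
coprime-∣ʳ c t∣b = Coprime.sym (coprime-∣ˡ (Coprime.sym c) t∣b)

coprime-*ʳ : ∀ {a b c} → Coprime a b → Coprime a c → Coprime a (b * c)
coprime-*ʳ a⊥b a⊥c (t∣a , t∣bc) = a⊥c (t∣a , coprime-divisor (coprime-∣ˡ a⊥b t∣a) t∣bc)

prime∤⇒coprime : ∀ {p x} → Prime p → ¬ p ∣ x → Coprime x p
prime∤⇒coprime p-prime p∤x (t∣x , t∣p) with prime⇒irreducible p-prime t∣p
... | inj₁ t≡1 = t≡1
... | inj₂ refl = ⊥-elim (p∤x t∣x)

prime*n≡square⇒prime∣n : ∀ {p n z} → Prime p → p * n ≡ z * z → p ∣ n
prime*n≡square⇒prime∣n {p} {n} {z} p-prime pn≡zz
  with [ id , id ]′ (euclidsLemma z z p-prime (divides n (trans (sym pn≡zz) (*-comm p n))))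
... | divides t refl = divides (t * t) (*-cancelˡ-≡ _ _ p (trans pn≡zz (regroup t p)))
  where
  instance _ = prime⇒nonZero p-prime
  regroup : ∀ t p → (t * p) * (t * p) ≡ p * (t * t * p)
  regroup = solve-∀

prime∣product⁴ : ∀ {p} a b c e → Prime p → p ∣ a * b * c * e → p ∣ a ⊎ p ∣ b ⊎ p ∣ c ⊎ p ∣ e
prime∣product⁴ a b c e p-prime p∣abce with euclidsLemma (a * b * c) e p-prime p∣abce
... | inj₂ p∣e = inj₂ (inj₂ (inj₂ p∣e))
... | inj₁ p∣abc with euclidsLemma (a * b) c p-prime p∣abc
... | inj₂ p∣c = inj₂ (inj₂ (inj₁ p∣c))
... | inj₁ p∣ab with euclidsLemma a b p-prime p∣ab
... | inj₁ p∣a = inj₁ p∣a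
... | inj₂ p∣b = inj₂ (inj₁ p∣b)

∣square⇒∣gcd-square : ∀ a c → a ∣ c * c → a ∣ gcd a c * gcd a c
∣square⇒∣gcd-square a c a∣cc = subst (a ∣_) gcd-of-products (gcd-greatest a∣gcd[aa,ac] a∣gcd[ca,cc])
  where
  open ≡-Reasoning
  g = gcd a c
  a∣gcd[aa,ac] : a ∣ gcd (a * a) (a * c)
  a∣gcd[aa,ac] = gcd-greatest (m∣m*n a) (m∣m*n c)
  a∣gcd[ca,cc] : a ∣ gcd (c * a) (c * c)
  a∣gcd[ca,cc] = gcd-greatest (n∣m*n c) a∣cc
  gcd-of-products : gcd (gcd (a * a) (a * c)) (gcd (c * a) (c * c)) ≡ g * g
  gcd-of-products = begin
    gcd (gcd (a * a) (a * c)) (gcd (c * a) (c * c))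
      ≡⟨ cong₂ gcd (sym (c*gcd[m,n]≡gcd[cm,cn] a a c)) (sym (c*gcd[m,n]≡gcd[cm,cn] c a c)) ⟩
    gcd (a * g) (c * g) ≡⟨ cong₂ gcd (*-comm a g) (*-comm c g) ⟩
    gcd (g * a) (g * c) ≡⟨ sym (c*gcd[m,n]≡gcd[cm,cn] g a c) ⟩
    g * g               ∎

coprime-product-square : ∀ {a b c} → Coprime a b → a * b ≡ c * c → IsSquare a
coprime-product-square {a} {b} {c} a⊥b ab≡cc = g , ∣-antisym (∣square⇒∣gcd-square a c a∣cc) gg∣a
  where
  g = gcd a c
  a∣cc : a ∣ c * c
  a∣cc = subst (a ∣_) ab≡cc (m∣m*n b)
  g⊥b : Coprime g b
  g⊥b = coprime-∣ˡ a⊥b (gcd[m,n]∣m a c)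
  gg∣ba : g * g ∣ b * a
  gg∣ba = subst (g * g ∣_) (trans (sym ab≡cc) (*-comm a b)) (*-pres-∣ (gcd[m,n]∣n a c) (gcd[m,n]∣n a c))
  gg∣a : g * g ∣ a
  gg∣a = coprime-divisor (Coprime.sym (coprime-*ʳ (Coprime.sym g⊥b) (Coprime.sym g⊥b))) gg∣ba

coprime-factor-square : ∀ {p x y z} → Prime p → ¬ p ∣ x → Coprime x y → x * (p * y) ≡ z * z → IsSquare x
coprime-factor-square {z = z} p-prime p∤x x⊥y = coprime-product-square {c = z} (coprime-*ʳ (prime∤⇒coprime p-prime p∤x) x⊥y)

square-cancelˡ : ∀ {k n w} → k ≢ 0 → (k * k) * n ≡ w * w → IsSquare n
square-cancelˡ {k} {n} {w} k≢0 kkn≡ww = w′ , n≡w′w′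
  where
  g = gcd k w
  instance
    g≢0 : NonZero g
    g≢0 = ≢-nonZero (k≢0 ∘ gcd[m,n]≡0⇒m≡0)
    gg≢0 : NonZero (g * g)
    gg≢0 = m*n≢0 g g
  k′ w′ : ℕ
  k′ = quotient (gcd[m,n]∣m k w)
  w′ = quotient (gcd[m,n]∣n k w)
  k≡k′g : k ≡ k′ * g
  k≡k′g = m∣n⇒n≡quotient*m (gcd[m,n]∣m k w)
  w≡w′g : w ≡ w′ * g
  w≡w′g = m∣n⇒n≡quotient*m (gcd[m,n]∣n k w)
  k′⊥w′ : Coprime k′ w′
  k′⊥w′ = Coprime.Bézout-coprime (subst₂ (Bézout.Identity g) k≡k′g w≡w′g (Bézout.identity (gcd-GCD k w)))
  regroupˡ : ∀ k′ g n → (g * g) * (k′ * k′ * n) ≡ (k′ * g) * (k′ * g) * n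
  regroupˡ = solve-∀
  regroupʳ : ∀ w′ g → (w′ * g) * (w′ * g) ≡ (g * g) * (w′ * w′)
  regroupʳ = solve-∀
  k′k′n≡w′w′ : k′ * k′ * n ≡ w′ * w′
  k′k′n≡w′w′ = *-cancelˡ-≡ _ _ (g * g) (begin
    (g * g) * (k′ * k′ * n) ≡⟨ regroupˡ k′ g n ⟩
    (k′ * g) * (k′ * g) * n ≡⟨ cong (λ x → x * x * n) (sym k≡k′g) ⟩
    k * k * n               ≡⟨ kkn≡ww ⟩
    w * w                   ≡⟨ cong (λ x → x * x) w≡w′g ⟩
    (w′ * g) * (w′ * g)     ≡⟨ regroupʳ w′ g ⟩
    (g * g) * (w′ * w′)     ∎)
    where open ≡-Reasoning
  k′≡1 : k′ ≡ 1
  k′≡1 = k′⊥w′ (∣-refl , coprime-divisor k′⊥w′ (subst (k′ ∣_) k′k′n≡w′w′ (∣m⇒∣m*n n (m∣m*n k′))))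
  n≡w′w′ : n ≡ w′ * w′
  n≡w′w′ = trans (sym (*-identityˡ n)) (trans (cong (λ x → x * x * n) (sym k′≡1)) k′k′n≡w′w′)

module _ (d : ℕ) .{{_ : NonZero d}} where

  %-cong-+ : ∀ {a b x y} → a % d ≡ b % d → x % d ≡ y % d → (a + x) % d ≡ (b + y) % d
  %-cong-+ {a} {b} {x} {y} a≡b x≡y =
    trans (%-distribˡ-+ a x d) (trans (cong₂ (λ u v → (u + v) % d) a≡b x≡y) (sym (%-distribˡ-+ b y d)))

  %-cong-* : ∀ {a b x y} → a % d ≡ b % d → x % d ≡ y % d → (a * x) % d ≡ (b * y) % d
  %-cong-* {a} {b} {x} {y} a≡b x≡y =
    trans (%-distribˡ-* a x d) (trans (cong₂ (λ u v → (u * v) % d) a≡b x≡y) (sym (%-distribˡ-* b y d)))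

  -- Bézout may only give w y ≡ −1 (mod d); its square is 1 either way.
  square-inverse : ∀ {y} → Coprime d y → ∃[ w ] ((w * y) * (w * y)) % d ≡ 1 % d
  square-inverse {y} d⊥y with coprime-Bézout d⊥y
  ... | Bézout.+- x w 1+wy≡xd = w , (begin
    (t * t) % d                    ≡⟨ sym ([m+kn]%n≡m%n (t * t) (2 * x) d) ⟩
    (t * t + 2 * x * d) % d        ≡⟨ cong (_% d) (begin
      t * t + 2 * x * d            ≡⟨ reassoc t x d ⟩
      t * t + 2 * (x * d)          ≡⟨ cong (λ u → t * t + 2 * u) (sym 1+wy≡xd) ⟩
      t * t + 2 * (1 + t)          ≡⟨ complete-square t ⟩
      1 + (1 + t) * (1 + t)        ≡⟨ cong (λ u → 1 + u * u) 1+wy≡xd ⟩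
      1 + (x * d) * (x * d)        ≡⟨ reassoc′ x d ⟩
      1 + x * x * d * d            ∎) ⟩
    (1 + x * x * d * d) % d        ≡⟨ [m+kn]%n≡m%n 1 (x * x * d) d ⟩
    1 % d                          ∎)
    where
    open ≡-Reasoning
    t = w * y
    reassoc : ∀ t x d → t * t + 2 * x * d ≡ t * t + 2 * (x * d)
    reassoc = solve-∀
    complete-square : ∀ t → t * t + 2 * (1 + t) ≡ 1 + (1 + t) * (1 + t)
    complete-square = solve-∀
    reassoc′ : ∀ x d → 1 + (x * d) * (x * d) ≡ 1 + x * x * d * d
    reassoc′ = solve-∀
  ... | Bézout.-+ x w 1+xd≡wy = w , (begin
    ((w * y) * (w * y)) % d        ≡⟨ cong (λ u → (u * u) % d) (sym 1+xd≡wy) ⟩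
    ((1 + x * d) * (1 + x * d)) % d ≡⟨ cong (_% d) (expand x d) ⟩
    (1 + (2 * x + x * x * d) * d) % d ≡⟨ [m+kn]%n≡m%n 1 (2 * x + x * x * d) d ⟩
    1 % d                          ∎)
    where
    open ≡-Reasoning
    expand : ∀ x d → (1 + x * d) * (1 + x * d) ≡ 1 + (2 * x + x * x * d) * d
    expand = solve-∀

  residue-from-divisor : ∀ {y c} → y < d → 0 < c → c < d → d ∣ y * y + c → QuadraticResidue d (d ∸ c)
  residue-from-divisor {y} {c} y<d 0<c c<d (divides zero yy+c≡0) = ⊥-elim (<⇒≢ 0<c (sym (m+n≡0⇒n≡0 _ yy+c≡0)))
  residue-from-divisor {y} {c} y<d 0<c c<d (divides (suc K) yy+c≡d+Kd) = y , 1≤y , y<d , K , yy≡Kd+[d∸c]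
    where
    open ≡-Reasoning
    yy≡Kd+[d∸c] : y * y ≡ K * d + (d ∸ c)
    yy≡Kd+[d∸c] = +-cancelʳ-≡ c _ _ (begin
      y * y + c           ≡⟨ yy+c≡d+Kd ⟩
      d + K * d           ≡⟨ +-comm d (K * d) ⟩
      K * d + d           ≡⟨ cong (K * d +_) (sym (m∸n+n≡m (<⇒≤ c<d))) ⟩
      K * d + (d ∸ c + c) ≡⟨ sym (+-assoc (K * d) (d ∸ c) c) ⟩
      K * d + (d ∸ c) + c ∎)
    d≤c[y≡0] : y ≡ 0 → d ≤ c
    d≤c[y≡0] refl = subst (d ≤_) (sym yy+c≡d+Kd) (m≤m+n d (K * d))
    1≤y : 1 ≤ y
    1≤y = n≢0⇒n>0 (<⇒≱ c<d ∘ d≤c[y≡0])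

  residue-criterion : ∀ {x y c} → Coprime d y → 0 < c → c < d →
                      d ∣ x * x + c * (y * y) → QuadraticResidue d (d ∸ c)
  residue-criterion {x} {y} {c} d⊥y 0<c c<d d∣xx+cyy with square-inverse d⊥y
  ... | w , [wy]²≡1 = residue-from-divisor (m%n<n (w * x) d) 0<c c<d (m%n≡0⇒n∣m _ d (begin
    (r * r + c) % d                             ≡⟨ %-cong-+ {b = w * x * (w * x)} (%-cong-* r≡wx r≡wx) refl ⟩
    (w * x * (w * x) + c) % d                   ≡⟨ cong (λ u → (w * x * (w * x) + u) % d) (sym (*-identityʳ c)) ⟩
    (w * x * (w * x) + c * 1) % d               ≡⟨ %-cong-+ {a = w * x * (w * x)} refl (%-cong-* {a = c} refl (sym [wy]²≡1)) ⟩
    (w * x * (w * x) + c * (w * y * (w * y))) % d ≡⟨ cong (_% d) (factor w x y c) ⟩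
    (w * w * (x * x + c * (y * y))) % d         ≡⟨ n∣m⇒m%n≡0 _ d (∣n⇒∣m*n (w * w) d∣xx+cyy) ⟩
    0                                           ∎))
    where
    open ≡-Reasoning
    r : ℕ
    r = (w * x) % d
    r≡wx : r % d ≡ (w * x) % d
    r≡wx = m%n%n≡m%n (w * x) d
    factor : ∀ w x y c → w * x * (w * x) + c * (w * y * (w * y)) ≡ w * w * (x * x + c * (y * y))
    factor = solve-∀

half-difference-of-legs : ∀ {x h b} → Odd x → x * x + (2 * h) * (2 * h) ≡ b * b → ∃[ g ] g * (x + g) ≡ h * h
half-difference-of-legs {x} {h} {b} x-odd@(a , x≡1+2a) xx+4hh≡bb with odd-≤-odd x-odd b-odd x≤b
  where
  b-odd : Odd b
  b-odd = odd-square⇒odd (2 * a * a + 2 * a + 2 * h * h , (begin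
    b * b                                   ≡⟨ sym xx+4hh≡bb ⟩
    x * x + (2 * h) * (2 * h)               ≡⟨ cong (λ u → u * u + (2 * h) * (2 * h)) x≡1+2a ⟩
    (1 + 2 * a) * (1 + 2 * a) + (2 * h) * (2 * h) ≡⟨ expand a h ⟩
    1 + 2 * (2 * a * a + 2 * a + 2 * h * h) ∎))
    where
    open ≡-Reasoning
    expand : ∀ a h → (1 + 2 * a) * (1 + 2 * a) + (2 * h) * (2 * h) ≡ 1 + 2 * (2 * a * a + 2 * a + 2 * h * h)
    expand = solve-∀
  x≤b : x ≤ b
  x≤b = square-cancel-≤ (subst (x * x ≤_) xx+4hh≡bb (m≤m+n (x * x) _))
... | g , b≡x+2g = g , *-cancelˡ-≡ _ _ 4 (+-cancelˡ-≡ (x * x) _ _ (begin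
  x * x + 4 * (g * (x + g))  ≡⟨ expand x g ⟩
  (x + 2 * g) * (x + 2 * g)  ≡⟨ cong (λ u → u * u) (sym b≡x+2g) ⟩
  b * b                      ≡⟨ sym xx+4hh≡bb ⟩
  x * x + (2 * h) * (2 * h)  ≡⟨ regroup x h ⟩
  x * x + 4 * (h * h)        ∎))
  where
  open ≡-Reasoning
  expand : ∀ x g → x * x + 4 * (g * (x + g)) ≡ (x + 2 * g) * (x + 2 * g)
  expand = solve-∀
  regroup : ∀ x h → x * x + (2 * h) * (2 * h) ≡ x * x + 4 * (h * h)
  regroup = solve-∀

pythagorean-generators : ∀ {x h} g → 0 < x → 0 < h → Coprime x h → g * (x + g) ≡ h * h →
                         ∃[ s ] ∃[ p ] 0 < s × 0 < p × Coprime s p × x ≡ p * (s + (s + p)) × h ≡ s * (s + p)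
pythagorean-generators {x} {h} g 0<x 0<h x⊥h g[x+g]≡hh =
  s , p , 0<s , m<n⇒0<n∸m s<r , s⊥p , x≡p[2s+p] , trans h≡sr (cong (s *_) (sym s+p≡r))
  where
  open ≡-Reasoning
  g⊥x+g : Coprime g (x + g)
  g⊥x+g {t} (t∣g , t∣x+g) = coprime-*ʳ x⊥h x⊥h
    (∣m+n∣m⇒∣n (subst (t ∣_) (+-comm x g) t∣x+g) t∣g , subst (t ∣_) g[x+g]≡hh (∣m⇒∣m*n (x + g) t∣g))
  g-square : IsSquare g
  g-square = coprime-product-square {c = h} g⊥x+g g[x+g]≡hh
  x+g-square : IsSquare (x + g)
  x+g-square = coprime-product-square {c = h} (Coprime.sym g⊥x+g) (trans (*-comm (x + g) g) g[x+g]≡hh)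
  s r : ℕ
  s = proj₁ g-square
  r = proj₁ x+g-square
  g≡ss : g ≡ s * s
  g≡ss = proj₂ g-square
  x+g≡rr : x + g ≡ r * r
  x+g≡rr = proj₂ x+g-square
  regroup : ∀ s r → s * s * (r * r) ≡ (s * r) * (s * r)
  regroup = solve-∀
  h≡sr : h ≡ s * r
  h≡sr = square-injective (begin
    h * h             ≡⟨ sym g[x+g]≡hh ⟩
    g * (x + g)       ≡⟨ cong₂ _*_ g≡ss x+g≡rr ⟩
    s * s * (r * r)   ≡⟨ regroup s r ⟩
    (s * r) * (s * r) ∎)
  0<s : 0 < s
  0<s = n≢0⇒n>0 λ s≡0 → <⇒≢ 0<h (sym (trans h≡sr (cong (_* r) s≡0)))
  s<r : s < r
  s<r = square-cancel-< (subst₂ _<_ g≡ss x+g≡rr (m<n+m g 0<x))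
  p : ℕ
  p = r ∸ s
  s+p≡r : s + p ≡ r
  s+p≡r = m+[n∸m]≡n (<⇒≤ s<r)
  s⊥p : Coprime s p
  s⊥p {t} (t∣s , t∣p) = g⊥x+g (subst (t ∣_) (sym g≡ss) (∣m⇒∣m*n s t∣s) , subst (t ∣_) (sym x+g≡rr) (∣m⇒∣m*n r t∣r))
    where t∣r = subst (t ∣_) s+p≡r (∣m∣n⇒∣m+n t∣s t∣p)
  expand : ∀ s p → (s + p) * (s + p) ≡ p * (s + (s + p)) + s * s
  expand = solve-∀
  x≡p[2s+p] : x ≡ p * (s + (s + p))
  x≡p[2s+p] = +-cancelʳ-≡ (s * s) _ _ (begin
    x + s * s                ≡⟨ cong (x +_) (sym g≡ss) ⟩
    x + g                    ≡⟨ x+g≡rr ⟩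
    r * r                    ≡⟨ cong (λ u → u * u) (sym s+p≡r) ⟩
    (s + p) * (s + p)        ≡⟨ expand s p ⟩
    p * (s + (s + p)) + s * s ∎)

one-leg-even : ∀ {c v} → Odd c → 0 < v → Coprime (c + v) v →
               ∃[ x ] ∃[ h ] Odd x × 0 < x × 0 < h × Coprime x h ×
                 x * x + (2 * h) * (2 * h) ≡ (c + v) * (c + v) + v * v × (c + v) * v ≡ x * (2 * h)
one-leg-even {c} {v} (a , refl) 0<v u⊥v with even-or-odd v
... | inj₁ (h , refl) = c + v , h , (a + h , collect a h) , ≤-trans 0<v (m≤n+m v c) ,
                        n≢0⇒n>0 (λ { refl → <⇒≢ 0<v refl }) , coprime-∣ʳ u⊥v (n∣m*n 2) , refl , refl
  where
  collect : ∀ a h → 1 + 2 * a + 2 * h ≡ 1 + 2 * (a + h)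
  collect = solve-∀
... | inj₂ (b , refl) = v , suc (a + b) , (b , refl) , 0<v , s≤s z≤n ,
                        Coprime.sym (coprime-∣ˡ u⊥v (subst (suc (a + b) ∣_) (sym (collect a b)) (n∣m*n 2))) ,
                        trans (+-comm (v * v) _) (cong (λ u → u * u + v * v) (sym (collect a b))) ,
                        trans (*-comm (c + v) v) (cong (v *_) (collect a b))
  where
  collect : ∀ a b → 1 + 2 * a + (1 + 2 * b) ≡ 2 * suc (a + b)
  collect = solve-∀

progression-triangle : ∀ {e p c f} → 0 < e → Coprime e p → Odd p → p ≡ c * c → e + (e + p) ≡ f * f →
                       ∃[ x ] ∃[ h ] Odd x × 0 < x × 0 < h × Coprime x h ×
                         x * x + (2 * h) * (2 * h) ≡ e + p × e ≡ 4 * x * h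
progression-triangle {e} {p} {c} {f} 0<e e⊥p p-odd@(a , p≡1+2a) p≡cc 2e+p≡ff =
  let x , h , x-odd , 0<x , 0<h , x⊥h , sum , product = one-leg-even c-odd 0<v c+v⊥v
  in  x , h , x-odd , 0<x , 0<h , x⊥h , trans sum (sym e+p≡uu+vv) , (begin
        e                   ≡⟨ e≡2v[c+v] ⟩
        2 * v * (c + v)     ≡⟨ *-assoc 2 v (c + v) ⟩
        2 * (v * (c + v))   ≡⟨ cong (2 *_) (trans (*-comm v (c + v)) product) ⟩
        2 * (x * (2 * h))   ≡⟨ regroup x h ⟩
        4 * x * h           ∎)
  where
  open ≡-Reasoning
  c-odd : Odd c
  c-odd = odd-square⇒odd (subst Odd p≡cc p-odd)
  collect : ∀ e a → e + (e + (1 + 2 * a)) ≡ 1 + 2 * (a + e)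
  collect = solve-∀
  f-odd : Odd f
  f-odd = odd-square⇒odd (a + e , trans (sym 2e+p≡ff) (trans (cong (λ u → e + (e + u)) p≡1+2a) (collect e a)))
  c≤f : c ≤ f
  c≤f = square-cancel-≤ (subst₂ _≤_ p≡cc 2e+p≡ff (≤-trans (m≤n+m p e) (m≤n+m (e + p) e)))
  v : ℕ
  v = proj₁ (odd-≤-odd c-odd f-odd c≤f)
  f≡c+2v : f ≡ c + 2 * v
  f≡c+2v = proj₂ (odd-≤-odd c-odd f-odd c≤f)
  double : ∀ e c → c * c + 2 * e ≡ e + (e + c * c)
  double = solve-∀
  expand : ∀ c v → (c + 2 * v) * (c + 2 * v) ≡ c * c + 2 * (2 * v * (c + v))
  expand = solve-∀
  e≡2v[c+v] : e ≡ 2 * v * (c + v)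
  e≡2v[c+v] = *-cancelˡ-≡ _ _ 2 (+-cancelˡ-≡ (c * c) _ _ (begin
    c * c + 2 * e                 ≡⟨ double e c ⟩
    e + (e + c * c)               ≡⟨ cong (λ u → e + (e + u)) (sym p≡cc) ⟩
    e + (e + p)                   ≡⟨ 2e+p≡ff ⟩
    f * f                         ≡⟨ cong (λ u → u * u) f≡c+2v ⟩
    (c + 2 * v) * (c + 2 * v)     ≡⟨ expand c v ⟩
    c * c + 2 * (2 * v * (c + v)) ∎))
  0<v : 0 < v
  0<v = n≢0⇒n>0 λ v≡0 → <⇒≢ 0<e (sym (trans e≡2v[c+v] (cong (λ u → 2 * u * (c + u)) v≡0)))
  c+v⊥v : Coprime (c + v) v
  c+v⊥v {t} (t∣c+v , t∣v) = e⊥p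
    ( subst (t ∣_) (sym e≡2v[c+v]) (∣n⇒∣m*n (2 * v) t∣c+v)
    , subst (t ∣_) (sym p≡cc) (∣m⇒∣m*n c (∣m+n∣m⇒∣n (subst (t ∣_) (+-comm c v) t∣c+v) t∣v)))
  rearrange : ∀ c v → 2 * v * (c + v) + c * c ≡ (c + v) * (c + v) + v * v
  rearrange = solve-∀
  e+p≡uu+vv : e + p ≡ (c + v) * (c + v) + v * v
  e+p≡uu+vv = trans (cong₂ _+_ e≡2v[c+v] p≡cc) (rearrange c v)
  regroup : ∀ x h → 2 * (x * (2 * h)) ≡ 4 * x * h
  regroup = solve-∀

generators-bound : ∀ {s q h x} → 0 < s → h ≡ s * (s + q) → s + q < x * x + (2 * h) * (2 * h)
generators-bound {s} {q} {h} {x} 0<s h≡s[s+q] = begin-strict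
  s + q                       ≤⟨ m≤n*m (s + q) s ⟩
  s * (s + q)                 ≡⟨ sym h≡s[s+q] ⟩
  h                           <⟨ m<m*n h 2 ≤-refl ⟩
  h * 2                       ≡⟨ *-comm h 2 ⟩
  2 * h                       ≤⟨ m≤m*n (2 * h) (2 * h) ⟩
  (2 * h) * (2 * h)           ≤⟨ m≤n+m ((2 * h) * (2 * h)) (x * x) ⟩
  x * x + (2 * h) * (2 * h)   ∎
  where
  open ≤-Reasoning
  instance
    s≢0 : NonZero s
    s≢0 = >-nonZero 0<s
    h≢0 : NonZero h
    h≢0 = subst NonZero (sym h≡s[s+q]) (m*n≢0 s (s + q) {{s≢0}} {{>-nonZero (≤-trans 0<s (m≤m+n s q))}})
    2h≢0 : NonZero (2 * h)
    2h≢0 = m*n≢0 2 h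

-- Area of the right triangle with legs m² − e² and 2em, written with m = e + p.
area : ℕ → ℕ → ℕ
area e p = e * (e + p) * p * (e + (e + p))

area-descent : ∀ {e p b c f} → 0 < e → Coprime e p → Odd p →
               e + p ≡ b * b → p ≡ c * c → e + (e + p) ≡ f * f →
               ∃[ s ] ∃[ q ] s + q < e + p × 0 < s × 0 < q × Coprime s q × e ≡ 4 * area s q
area-descent {e} {p} {b} {c} {f} 0<e e⊥p p-odd e+p≡bb p≡cc 2e+p≡ff =
  case progression-triangle {c = c} {f} 0<e e⊥p p-odd p≡cc 2e+p≡ff of λ
  { (x , h , x-odd , 0<x , 0<h , x⊥h , xx+4hh≡e+p , e≡4xh) →
  case half-difference-of-legs {h = h} {b} x-odd (trans xx+4hh≡e+p e+p≡bb) of λ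
  { (g , g[x+g]≡hh) →
  case pythagorean-generators g 0<x 0<h x⊥h g[x+g]≡hh of λ
  { (s , q , 0<s , 0<q , s⊥q , x≡q[2s+q] , h≡s[s+q]) →
    s , q , subst (s + q <_) xx+4hh≡e+p (generators-bound {x = x} 0<s h≡s[s+q]) , 0<s , 0<q , (λ {t} → s⊥q {t}) ,
    trans e≡4xh (trans (cong₂ (λ u v → 4 * u * v) x≡q[2s+q] h≡s[s+q]) (regroup s q)) } } }
  where
  regroup : ∀ s q → 4 * (q * (s + (s + q))) * (s * (s + q)) ≡ 4 * (s * (s + q) * q * (s + (s + q)))
  regroup = solve-∀

-- If d · area e p = z², the triangle rescaled by d / z is rational with area d: d is a congruent number.
Witness : ℕ → ℕ → ℕ → Set
Witness d e p = Coprime e p × 0 < e × 0 < p × IsSquare (d * area e p)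

SmallerWitness : ℕ → ℕ → Set
SmallerWitness d n = ∃[ e ] ∃[ p ] e + p < n × Witness d e p

even-descent : ∀ {d e h} → Witness d e (2 * h) → SmallerWitness d (e + 2 * h)
even-descent {d} {e} {h} (e⊥2h , 0<e , 0<2h , z , dA≡zz) =
  h , e , h+e<e+2h , Coprime.sym (coprime-∣ʳ e⊥2h (n∣m*n 2)) , 0<h , 0<e ,
  square-cancelˡ {k = 2} {w = z} (λ ()) (trans (regroup d e h) dA≡zz)
  where
  0<h : 0 < h
  0<h = n≢0⇒n>0 λ { refl → <⇒≢ 0<2h refl }
  shift : ∀ e h → h + e + h ≡ e + 2 * h
  shift = solve-∀
  h+e<e+2h : h + e < e + 2 * h
  h+e<e+2h = subst (h + e <_) (shift e h) (m<m+n (h + e) 0<h)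
  regroup : ∀ d e h → (2 * 2) * (d * (h * (h + e) * e * (h + (h + e)))) ≡ d * (e * (e + 2 * h) * (2 * h) * (e + (e + 2 * h)))
  regroup = solve-∀

area-factors-coprime : ∀ {e p} → Coprime e p → Odd p →
                       let m = e + p ; q = e + m in
                       Coprime e (m * (p * q)) × Coprime m (e * (p * q)) ×
                       Coprime p (e * (m * q)) × Coprime q (e * (m * p))
area-factors-coprime {e} {p} e⊥p (a , p≡1+2a) =
  coprime-*ʳ e⊥m (coprime-*ʳ e⊥p e⊥q) ,
  coprime-*ʳ (Coprime.sym e⊥m) (coprime-*ʳ m⊥p m⊥q) ,
  coprime-*ʳ (Coprime.sym e⊥p) (coprime-*ʳ (Coprime.sym m⊥p) p⊥q) ,
  coprime-*ʳ (Coprime.sym e⊥q) (coprime-*ʳ (Coprime.sym m⊥q) (Coprime.sym p⊥q))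
  where
  m q : ℕ
  m = e + p
  q = e + m
  e⊥m : Coprime e m
  e⊥m (t∣e , t∣m) = e⊥p (t∣e , ∣m+n∣m⇒∣n t∣m t∣e)
  e⊥q : Coprime e q
  e⊥q (t∣e , t∣q) = e⊥m (t∣e , ∣m+n∣m⇒∣n t∣q t∣e)
  m⊥p : Coprime m p
  m⊥p {t} (t∣m , t∣p) = e⊥p (∣m+n∣m⇒∣n (subst (t ∣_) (+-comm e p) t∣m) t∣p , t∣p)
  m⊥q : Coprime m q
  m⊥q {t} (t∣m , t∣q) = e⊥m (∣m+n∣m⇒∣n (subst (t ∣_) (+-comm e m) t∣q) t∣m , t∣m)
  p⊥2 : Coprime p 2
  p⊥2 = prime∤⇒coprime prime[2] λ 2∣p →
    contradiction (∣1⇒≡1 (∣m+n∣m⇒∣n (subst (2 ∣_) (trans p≡1+2a (+-comm 1 (2 * a))) 2∣p) (m∣m*n a))) λ ()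
  regroup : ∀ e p → e + (e + p) ≡ p + 2 * e
  regroup = solve-∀
  p⊥q : Coprime p q
  p⊥q {t} (t∣p , t∣q) = e⊥p (coprime-divisor (coprime-∣ˡ p⊥2 t∣p) t∣2e , t∣p)
    where t∣2e = ∣m+n∣m⇒∣n (subst (t ∣_) (regroup e p) t∣q) t∣p

module _ {d : ℕ} (d-prime : Prime d) (3<d : 3 < d)
         (nonresidue[-1] : QuadraticNonresidue d (d ∸ 1))
         (nonresidue[2] : QuadraticNonresidue d 2) where

  private instance
    d≢0 : NonZero d
    d≢0 = prime⇒nonZero d-prime

  2<d : 2 < d
  2<d = <-trans (s≤s (s≤s (s≤s z≤n))) 3<d

  1<d : 1 < d
  1<d = <-trans (s≤s (s≤s z≤n)) 2<d

  coprime-∣⇒∤ : ∀ {x y} → Coprime x y → d ∣ y → ¬ d ∣ x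
  coprime-∣⇒∤ x⊥y d∣y d∣x = <⇒≢ 1<d (sym (x⊥y (d∣x , d∣y)))

  ∤-square⇒coprime-root : ∀ {x a} → x ≡ a * a → ¬ d ∣ x → Coprime d a
  ∤-square⇒coprime-root {a = a} x≡aa d∤x = Coprime.sym (prime∤⇒coprime d-prime (λ d∣a → d∤x (subst (d ∣_) (sym x≡aa) (∣m⇒∣m*n a d∣a))))

  ∤-sum-of-squares : ∀ {a c} → Coprime d a → ¬ d ∣ a * a + c * c
  ∤-sum-of-squares {a} {c} d⊥a d∣aa+cc =
    nonresidue[-1] (residue-criterion d {x = c} d⊥a (s≤s z≤n) 1<d (subst (d ∣_) (swap a c) d∣aa+cc))
    where
    swap : ∀ a c → a * a + c * c ≡ c * c + 1 * (a * a)
    swap = solve-∀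

  ∤-square-minus-twice-square : ∀ {a n f} → Coprime d a → d ∣ n → n + 2 * (a * a) ≢ f * f
  ∤-square-minus-twice-square {a} {n} {f} d⊥a d∣n n+2aa≡ff =
    nonresidue[2] (subst (QuadraticResidue d) (m∸[m∸n]≡n (<⇒≤ 2<d))
      (residue-criterion d {x = f} d⊥a (m<n⇒0<n∸m 2<d) (∸-monoʳ-< {o = 0} (s≤s z≤n) (<⇒≤ 2<d)) d∣ff+[d-2]aa))
    where
    open ≡-Reasoning
    regroup : ∀ n a r → n + 2 * (a * a) + r * (a * a) ≡ n + (2 + r) * (a * a)
    regroup = solve-∀
    d∣ff+[d-2]aa : d ∣ f * f + (d ∸ 2) * (a * a)
    d∣ff+[d-2]aa = subst (d ∣_) (sym (begin
      f * f + (d ∸ 2) * (a * a)               ≡⟨ cong (_+ (d ∸ 2) * (a * a)) (sym n+2aa≡ff) ⟩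
      n + 2 * (a * a) + (d ∸ 2) * (a * a)     ≡⟨ regroup n a (d ∸ 2) ⟩
      n + (2 + (d ∸ 2)) * (a * a)             ≡⟨ cong (λ k → n + k * (a * a)) (m+[n∸m]≡n (<⇒≤ 2<d)) ⟩
      n + d * (a * a)                         ∎)) (∣m∣n⇒∣m+n d∣n (m∣m*n (a * a)))

  odd-descent : ∀ {e p} → Odd p → Witness d e p → SmallerWitness d (e + p)
  odd-descent {e} {p} p-odd (e⊥p , 0<e , 0<p , z , dA≡zz) =
    [ d∣e-case , [ d∣m-case , [ d∣p-case , d∣q-case ]′ ]′ ]′
      (prime∣product⁴ e m p q d-prime (prime*n≡square⇒prime∣n {n = area e p} {z} d-prime dA≡zz))
    where
    open ≡-Reasoning
    m q : ℕ
    m = e + p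
    q = e + m
    factors = area-factors-coprime e⊥p p-odd
    e⊥mpq : Coprime e (m * (p * q))
    e⊥mpq = proj₁ factors
    m⊥epq : Coprime m (e * (p * q))
    m⊥epq = proj₁ (proj₂ factors)
    p⊥emq : Coprime p (e * (m * q))
    p⊥emq = proj₁ (proj₂ (proj₂ factors))
    q⊥emp : Coprime q (e * (m * p))
    q⊥emp = proj₂ (proj₂ (proj₂ factors))
    square-of : ∀ {x y} → Coprime x y → x * (d * y) ≡ d * area e p → ¬ d ∣ x → IsSquare x
    square-of x⊥y x[dy]≡dA d∤x = coprime-factor-square {z = z} d-prime d∤x x⊥y (trans x[dy]≡dA dA≡zz)
    isolateₑ : ∀ d e m p q → e * (d * (m * (p * q))) ≡ d * (e * m * p * q)
    isolateₑ = solve-∀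
    isolateₘ : ∀ d e m p q → m * (d * (e * (p * q))) ≡ d * (e * m * p * q)
    isolateₘ = solve-∀
    isolateₚ : ∀ d e m p q → p * (d * (e * (m * q))) ≡ d * (e * m * p * q)
    isolateₚ = solve-∀
    isolate₍q₎ : ∀ d e m p q → q * (d * (e * (m * p))) ≡ d * (e * m * p * q)
    isolate₍q₎ = solve-∀
    e-square : ¬ d ∣ e → IsSquare e
    e-square = square-of e⊥mpq (isolateₑ d e m p q)
    m-square : ¬ d ∣ m → IsSquare m
    m-square = square-of m⊥epq (isolateₘ d e m p q)
    p-square : ¬ d ∣ p → IsSquare p
    p-square = square-of p⊥emq (isolateₚ d e m p q)
    q-square : ¬ d ∣ q → IsSquare q
    q-square = square-of q⊥emp (isolate₍q₎ d e m p q)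

    d∣m-case : d ∣ m → SmallerWitness d (e + p)
    d∣m-case d∣m = ⊥-elim (case e-square d∤e ,′ p-square d∤p of λ
      { ((a , e≡aa) , (c , p≡cc)) →
        ∤-sum-of-squares {a} {c} (∤-square⇒coprime-root {a = a} e≡aa d∤e) (subst (d ∣_) (cong₂ _+_ e≡aa p≡cc) d∣m) })
      where
      d∤e = coprime-∣⇒∤ e⊥mpq (∣m⇒∣m*n (p * q) d∣m)
      d∤p = coprime-∣⇒∤ p⊥emq (∣n⇒∣m*n e (∣m⇒∣m*n q d∣m))

    d∣q-case : d ∣ q → SmallerWitness d (e + p)
    d∣q-case d∣q = ⊥-elim (case e-square d∤e ,′ m-square d∤m of λ
      { ((a , e≡aa) , (b , m≡bb)) →
        ∤-sum-of-squares {a} {b} (∤-square⇒coprime-root {a = a} e≡aa d∤e) (subst (d ∣_) (cong₂ _+_ e≡aa m≡bb) d∣q) })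
      where
      d∤e = coprime-∣⇒∤ e⊥mpq (∣n⇒∣m*n m (∣n⇒∣m*n p d∣q))
      d∤m = coprime-∣⇒∤ m⊥epq (∣n⇒∣m*n e (∣n⇒∣m*n p d∣q))

    d∣p-case : d ∣ p → SmallerWitness d (e + p)
    d∣p-case d∣p = ⊥-elim (case e-square d∤e ,′ q-square d∤q of λ
      { ((a , e≡aa) , (f , q≡ff)) →
        ∤-square-minus-twice-square {a} {f = f} (∤-square⇒coprime-root {a = a} e≡aa d∤e) d∣p (begin
          p + 2 * (a * a) ≡⟨ cong (λ x → p + 2 * x) (sym e≡aa) ⟩
          p + 2 * e       ≡⟨ double e p ⟩
          q               ≡⟨ q≡ff ⟩
          f * f           ∎) })
      where
      d∤e = coprime-∣⇒∤ e⊥mpq (∣n⇒∣m*n m (∣m⇒∣m*n q d∣p))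
      d∤q = coprime-∣⇒∤ q⊥emp (∣n⇒∣m*n e (∣n⇒∣m*n m d∣p))
      double : ∀ e p → p + 2 * e ≡ e + (e + p)
      double = solve-∀

    d∣e-case : d ∣ e → SmallerWitness d (e + p)
    d∣e-case d∣e = case m-square d∤m ,′ p-square d∤p ,′ q-square d∤q of λ
      { ((b , m≡bb) , (c , p≡cc) , (f , q≡ff)) →
        case area-descent {b = b} {c} {f} 0<e e⊥p p-odd m≡bb p≡cc q≡ff of λ
        { (s , r , s+r<e+p , 0<s , 0<r , s⊥r , e≡4A) →
          s , r , s+r<e+p , (λ {t} → s⊥r {t}) , 0<s , 0<r , d·area-square (d·e-square {b} {c} {f} m≡bb p≡cc q≡ff) e≡4A } }
      where
      d∤m = coprime-∣⇒∤ m⊥epq (∣m⇒∣m*n (p * q) d∣e)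
      d∤p = coprime-∣⇒∤ p⊥emq (∣m⇒∣m*n (m * q) d∣e)
      d∤q = coprime-∣⇒∤ q⊥emp (∣m⇒∣m*n (m * p) d∣e)
      regroup : ∀ d e b c f → (b * c * f) * (b * c * f) * (d * e) ≡ d * (e * (b * b) * (c * c) * (f * f))
      regroup = solve-∀
      d·e-square : ∀ {b c f} → m ≡ b * b → p ≡ c * c → q ≡ f * f → IsSquare (d * e)
      d·e-square {b} {c} {f} m≡bb p≡cc q≡ff = square-cancelˡ {k = b * c * f} {d * e} {z} bcf≢0 (begin
        (b * c * f) * (b * c * f) * (d * e)   ≡⟨ regroup d e b c f ⟩
        d * (e * (b * b) * (c * c) * (f * f)) ≡⟨ cong₂ (λ u v → d * (e * u * v * (f * f))) (sym m≡bb) (sym p≡cc) ⟩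
        d * (e * m * p * (f * f))             ≡⟨ cong (λ u → d * (e * m * p * u)) (sym q≡ff) ⟩
        d * area e p                          ≡⟨ dA≡zz ⟩
        z * z                                 ∎)
        where
        instance
          _ = ≢-nonZero (square≢0 (≤-trans 0<e (m≤m+n e p)) m≡bb)
          _ = ≢-nonZero (square≢0 0<p p≡cc)
          _ = ≢-nonZero (square≢0 (≤-trans 0<e (m≤m+n e m)) q≡ff)
        bcf≢0 : b * c * f ≢ 0
        bcf≢0 = ≢-nonZero⁻¹ (b * c * f) {{m*n≢0 (b * c) f {{m*n≢0 b c}}}}
      quadruple : ∀ d A → (2 * 2) * (d * A) ≡ d * (4 * A)
      quadruple = solve-∀
      d·area-square : ∀ {A} → IsSquare (d * e) → e ≡ 4 * A → IsSquare (d * A)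
      d·area-square {A} (w , de≡ww) e≡4A =
        square-cancelˡ {k = 2} {d * A} {w} (λ ()) (trans (quadruple d A) (trans (cong (d *_) (sym e≡4A)) de≡ww))

  descent : ∀ {e p} → Witness d e p → SmallerWitness d (e + p)
  descent {p = p} w with even-or-odd p
  ... | inj₁ (h , refl) = even-descent {d} {h = h} w
  ... | inj₂ p-odd      = odd-descent p-odd w

  no-witness : ∀ {e p} → ¬ Witness d e p
  no-witness {e} {p} = <-rec (λ n → ∀ {e p} → e + p ≡ n → ¬ Witness d e p) step (e + p) refl
    where
    step : ∀ n → (∀ {n′} → n′ < n → ∀ {e p} → e + p ≡ n′ → ¬ Witness d e p) →
           ∀ {e p} → e + p ≡ n → ¬ Witness d e p
    step _ smaller-impossible refl w =
      let _ , _ , smaller , w′ = descent w in smaller-impossible smaller refl w′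

square-difference : ∀ {e m} → e ≤ m → m ^ 2 ∸ e ^ 2 ≡ (m ∸ e) * (e + m)
square-difference {e} {m} e≤m = begin
  m ^ 2 ∸ e ^ 2                     ≡⟨ cong (λ u → u ^ 2 ∸ e ^ 2) (sym e+p≡m) ⟩
  (e + p) ^ 2 ∸ e ^ 2               ≡⟨ cong (_∸ e ^ 2) (expand e p) ⟩
  e ^ 2 + p * (e + (e + p)) ∸ e ^ 2 ≡⟨ m+n∸m≡n (e ^ 2) _ ⟩
  p * (e + (e + p))                 ≡⟨ cong (λ u → p * (e + u)) e+p≡m ⟩
  p * (e + m)                       ∎
  where
  open ≡-Reasoning
  p = m ∸ e
  e+p≡m : e + p ≡ m
  e+p≡m = m+[n∸m]≡n e≤m
  -- x ^ 2 unfolds to x * (x * 1); the ring solver does not accept _^_.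
  expand : ∀ e p → (e + p) * ((e + p) * 1) ≡ e * (e * 1) + p * (e + (e + p))
  expand = solve-∀

equation⇒witness : ∀ {d k j m e} → 0 < d → gcd m e ≡ 1 → gcd k j ≡ 1 → e < m → 0 < e →
                   d * (4 * j ^ 2 * e * m) ≡ k ^ 2 * (m ^ 2 ∸ e ^ 2) → Witness d e (m ∸ e)
equation⇒witness {d} {k} {j} {m} {e} 0<d gcd[m,e]≡1 gcd[k,j]≡1 e<m 0<e eq =
  e⊥p , 0<e , m<n⇒0<n∸m e<m , square-cancelˡ {w = 2 * d * j * e * m} k≢0 (begin
    k * k * (d * area e p)                      ≡⟨ cong (λ u → k * k * (d * (e * u * p * (e + u)))) e+p≡m ⟩
    k * k * (d * (e * m * p * (e + m)))         ≡⟨ regroupˡ d e m k p ⟩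
    (d * e * m) * (k ^ 2 * (p * (e + m)))       ≡⟨ cong (λ u → d * e * m * (k ^ 2 * u)) (sym (square-difference (<⇒≤ e<m))) ⟩
    (d * e * m) * (k ^ 2 * (m ^ 2 ∸ e ^ 2))     ≡⟨ cong (d * e * m *_) (sym eq) ⟩
    (d * e * m) * (d * (4 * j ^ 2 * e * m))     ≡⟨ regroupʳ d j e m ⟩
    (2 * d * j * e * m) * (2 * d * j * e * m)   ∎)
  where
  open ≡-Reasoning
  p = m ∸ e
  e+p≡m : e + p ≡ m
  e+p≡m = m+[n∸m]≡n (<⇒≤ e<m)
  e⊥p : Coprime e p
  e⊥p {t} (t∣e , t∣p) = gcd≡1⇒coprime gcd[m,e]≡1 (subst (t ∣_) e+p≡m (∣m∣n⇒∣m+n t∣e t∣p) , t∣e)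
  lhs-positive : ∀ {d j e m} → 0 < d → 0 < j → 0 < e → 0 < m → 0 < d * (4 * j ^ 2 * e * m)
  lhs-positive (s≤s z≤n) (s≤s z≤n) (s≤s z≤n) (s≤s z≤n) = s≤s z≤n
  -- k = 0 would force j = gcd 0 j = 1 and make the left-hand side vanish.
  k≢0 : k ≢ 0
  k≢0 refl = <⇒≢ (lhs-positive 0<d (subst (0 <_) (sym (trans (sym (gcd-identityˡ j)) gcd[k,j]≡1)) ≤-refl)
                                  0<e (<-trans 0<e e<m)) (sym eq)
  regroupˡ : ∀ d e m k p → k * k * (d * (e * m * p * (e + m))) ≡ (d * e * m) * (k * (k * 1) * (p * (e + m)))
  regroupˡ = solve-∀
  regroupʳ : ∀ d j e m → (d * e * m) * (d * (4 * (j * (j * 1)) * e * m)) ≡ (2 * d * j * e * m) * (2 * d * j * e * m)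
  regroupʳ = solve-∀

theorem1 : (d : ℕ) → Prime d → 3 < d →
    QuadraticNonresidue d (d ∸ 1) → QuadraticNonresidue d 2 →
    (k j m e : ℕ) → gcd m e ≡ 1 → gcd k j ≡ 1 → e < m → 0 < e →
    d * (4 * j ^ 2 * e * m) ≢ k ^ 2 * (m ^ 2 ∸ e ^ 2)
theorem1 d d-prime 3<d nonresidue[-1] nonresidue[2] k j m e gcd[m,e]≡1 gcd[k,j]≡1 e<m 0<e eq =
  no-witness d-prime 3<d nonresidue[-1] nonresidue[2]
    (equation⇒witness {d} {k} {j} {m} {e} (≤-trans (s≤s z≤n) 3<d) gcd[m,e]≡1 gcd[k,j]≡1 e<m 0<e eq)
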